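{- For every integer $k\ge 3$, let $T_k$ be the infinite $k$-regular tree. Then $\chi_L(T_k)=\infty$.
   Context: For a simple graph $G$ and integer $k\ge1$, a $k$-coloring is a map $c:V(G)\to\{1,\dots,k\}$ with adjacent vertices receiving different colors. With color classes $X_1,\dots,X_k$, the color code of $v$ is $(d(v,X_1),\dots,d(v,X_k))$, where $d(v,X_i)=\min_{x\in X_i}d(v,x)$. A locating $k$-coloring is a $k$-coloring in which all vertices have distinct color codes; the locating chromatic number $\chi_L(G)$ is the least such $k$, and $\chi_L(G)=\infty$ if no such $k$ exists. -}

module Defs where

open import Data.Nat using (ℕ; zero; suc; _≤_; _∸_)
open import Data.Fin using (Fin)
open import Data.List using (List; []; _∷_)
open import Data.Product using (Σ; ∃; _×_; _,_)
open import Data.Sum using (_⊎_)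
open import Relation.Binary.PropositionalEquality using (_≡_)
open import Relation.Nullary using (¬_)
open import Function.Bundles using (_⇔_)
open import Level using (0ℓ)

record Graph : Set₁ where
  field
    V     : Set
    Adj   : V → V → Set
    sym   : ∀ {u v} → Adj u v → Adj v u
    irrefl : ∀ {v} → ¬ Adj v v

module _ (G : Graph) where
  open Graph G

  data Walk : V → V → ℕ → Set where
    here : ∀ {v} → Walk v v 0
    step : ∀ {u w v n} → Adj u w → Walk w v n → Walk u v (suc n)

  Dist : V → V → ℕ → Set
  Dist u v n = Walk u v n × (∀ m → Walk u v m → n ≤ m)

  IsColoring : (k : ℕ) → (V → Fin k) → Set
  IsColoring k c = ∀ u v → Adj u v → ¬ (c u ≡ c v)

  -- d(v, X_i) = n, where X_i = c⁻¹(i).  (If X_i is empty, or at infinite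
  -- distance, there is no such n, i.e. the distance is ∞.)
  ColorDist : (k : ℕ) → (V → Fin k) → V → Fin k → ℕ → Set
  ColorDist k c v i n =
    (∃ λ x → c x ≡ i × Walk v x n) ×
    (∀ x m → c x ≡ i → Walk v x m → n ≤ m)

  SameCode : (k : ℕ) → (V → Fin k) → V → V → Set
  SameCode k c u v = ∀ i n → ColorDist k c u i n ⇔ ColorDist k c v i n

  IsLocatingColoring : (k : ℕ) → (V → Fin k) → Set
  IsLocatingColoring k c =
    IsColoring k c × (∀ u v → SameCode k c u v → u ≡ v)

  LocChromInfinite : Set
  LocChromInfinite = ∀ k (c : V → Fin k) → ¬ IsLocatingColoring k c

-- The infinite k-regular tree T_k.
-- Vertices: the root, or a path from the root: a first step (Fin k)
-- followed by further steps, each with k ∸ 1 choices (newest step first).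

data TVertex (k : ℕ) : Set where
  root : TVertex k
  node : Fin k → List (Fin (k ∸ 1)) → TVertex k

data Child (k : ℕ) : TVertex k → TVertex k → Set where
  top  : ∀ i → Child k root (node i [])
  deep : ∀ i p j → Child k (node i p) (node i (j ∷ p))

TAdj : (k : ℕ) → TVertex k → TVertex k → Set
TAdj k u v = Child k u v ⊎ Child k v u

private
  open import Data.Sum using (inj₁; inj₂)
  tsym : ∀ {k} {u v : TVertex k} → TAdj k u v → TAdj k v u
  tsym (inj₁ x) = inj₂ x
  tsym (inj₂ x) = inj₁ x

  noloop : ∀ {k} {v : TVertex k} → ¬ Child k v v
  noloop ()

  tirr : ∀ {k} {v : TVertex k} → ¬ TAdj k v v
  tirr (inj₁ x) = noloop x
  tirr (inj₂ x) = noloop x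

T : ℕ → Graph
T k = record { V = TVertex k ; Adj = TAdj k ; sym = tsym ; irrefl = tirr }

-- The argument is classical, which costs nothing because the goal is ⊥:
-- under a double negation we may decide finitely many propositions at once.
-- Given a colouring with m colours, every colour class that occurs has a
-- representative within some distance B of the root.  Hence every vertex v
-- at distance t + 1 from the root is within t + 1 + B of every occurring
-- colour, so the colour code of v takes at most (t + B + 3) ^ m values.  The
-- tree has 2 ^ t distinct vertices at distance t + 1 from the root (branch
-- along two fixed children at each step; this is where k ≥ 3 is used), and
-- 2 ^ t eventually exceeds (t + B + 3) ^ m, so two of them share a code.
module Submission where

open import Defs
open import Data.Nat using (ℕ; zero; suc; _+_; _*_; _^_; _∸_; _≤_; _<_; z≤n; s≤s; z<s; _⊔_)
open import Data.Nat.Properties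
open import Data.Nat.Solver using (module +-*-Solver)
open import Data.Fin using (Fin; zero; suc; toℕ; fromℕ<; inject≤; remQuot; combine; funToFin; finToFun)
import Data.Fin.Properties as Finₚ
open import Data.List using (List; []; _∷_)
open import Data.List.Properties using (∷-injectiveˡ; ∷-injectiveʳ)
open import Data.Product using (Σ; ∃; _×_; _,_; proj₁; proj₂; uncurry)
open import Data.Sum using (_⊎_; inj₁; inj₂)
open import Data.Empty using (⊥-elim)
open import Function.Base using (_∘_)
open import Function.Bundles using (_⇔_; mk⇔)
open import Function.Definitions using (Injective)
open import Relation.Nullary using (¬_; yes; no)
open import Relation.Nullary.Decidable using (¬¬-excluded-middle)
open import Relation.Nullary.Negation using (independence-of-premise)
open import Relation.Binary.PropositionalEquality

n<2^n : ∀ n → n < 2 ^ n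
n<2^n zero    = z<s
n<2^n (suc n) =
  subst (suc n <_) (cong (2 ^ n +_) (sym (+-identityʳ (2 ^ n))))
        (+-mono-≤-< (m^n>0 2 n) (n<2^n n))

linear<exponential : ∀ a m → ∃ λ j → j * m + a < 2 ^ j
linear<exponential a m = s + s , (begin-strict
  (s + s) * m + a           <⟨ +-monoʳ-< ((s + s) * m) (<-≤-trans a<s (m≤n+m s (s * a))) ⟩
  (s + s) * m + (s * a + s) ≡⟨ square s m a ⟨
  s * s                     <⟨ *-mono-< (n<2^n s) (n<2^n s) ⟩
  2 ^ s * 2 ^ s             ≡⟨ ^-distribˡ-+-* 2 s s ⟨
  2 ^ (s + s)               ∎)
  where
  open ≤-Reasoning
  open +-*-Solver
  s : ℕ
  s = suc (m + m + a)
  a<s : a < s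
  a<s = s≤s (m≤n+m a (m + m))
  square : ∀ s m a → s * suc (m + m + a) ≡ (s + s) * m + (s * a + s)
  square = solve 3 (λ s m a → s :* (con 1 :+ (m :+ m :+ a)) := (s :+ s) :* m :+ (s :* a :+ s)) refl

-- Take t with a + t a power of two, 2 ^ j, and compare exponents.
exponential-beats-polynomial : ∀ a m → ∃ λ t → (a + t) ^ m < 2 ^ t
exponential-beats-polynomial a m = t , (begin-strict
  (a + t) ^ m  ≡⟨ cong (_^ m) (m+[n∸m]≡n (m+n≤o⇒n≤o (j * m) (<⇒≤ jm+a<2^j))) ⟩
  (2 ^ j) ^ m  ≡⟨ ^-*-assoc 2 j m ⟩
  2 ^ (j * m)  <⟨ ^-monoʳ-< 2 (s≤s (s≤s z≤n)) (m+n≤o⇒m≤o∸n (suc (j * m)) jm+a<2^j) ⟩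
  2 ^ t        ∎)
  where
  open ≤-Reasoning
  j : ℕ
  j = proj₁ (linear<exponential a m)
  jm+a<2^j : j * m + a < 2 ^ j
  jm+a<2^j = proj₂ (linear<exponential a m)
  t : ℕ
  t = 2 ^ j ∸ a

¬¬-Π-Fin : ∀ {m} {Q : Fin m → Set} → (∀ i → ¬ ¬ Q i) → ¬ ¬ (∀ i → Q i)
¬¬-Π-Fin {zero}          _ k = k λ ()
¬¬-Π-Fin {suc m} {Q} h k =
  h zero λ q₀ → ¬¬-Π-Fin {Q = Q ∘ suc} (h ∘ suc) λ qₛ →
  k λ { zero → q₀ ; (suc i) → qₛ i }

Least : (ℕ → Set) → ℕ → Set
Least P n = P n × (∀ m → P m → n ≤ m)

¬¬-least : ∀ {P : ℕ → Set} n → P n → ¬ ¬ ∃ (Least P)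
¬¬-least zero p k = k (0 , p , λ _ _ → z≤n)
¬¬-least {P} (suc n) p k = ¬¬-excluded-middle λ where
  (yes p₀) → k (0 , p₀ , λ _ _ → z≤n)
  (no ¬p₀) → ¬¬-least {P ∘ suc} n p λ (l , pl , min) →
    k (suc l , pl , λ { zero p₀ → ⊥-elim (¬p₀ p₀) ; (suc m) pm → s≤s (min m pm) })

finite-bound : ∀ {m} {P : Fin m → ℕ → Set} → (∀ i → ∃ (P i)) →
               ∃ λ B → ∀ i → ∃ λ n → n ≤ B × P i n
finite-bound {zero}  _ = 0 , λ ()
finite-bound {suc m} {P} h with n₀ , p₀ ← h zero | B , bound ← finite-bound {P = P ∘ suc} (h ∘ suc) =
  n₀ ⊔ B , λ where
    zero    → n₀ , m≤m⊔n n₀ B , p₀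
    (suc i) → let n , n≤B , p = bound i in n , ≤-trans n≤B (m≤n⊔m n₀ B) , p

funToFin-injective : ∀ {m n} (f g : Fin m → Fin n) → funToFin f ≡ funToFin g → ∀ i → f i ≡ g i
funToFin-injective f g eq i =
  trans (sym (Finₚ.finToFun-funToFin f i))
        (trans (cong (λ z → finToFun z i) eq) (Finₚ.finToFun-funToFin g i))

module _ {G : Graph} where
  open Graph G using (Adj)

  _++ʷ_ : ∀ {u v w a b} → Walk G u v a → Walk G v w b → Walk G u w (a + b)
  here     ++ʷ q = q
  step e p ++ʷ q = step e (p ++ʷ q)

  _▷_ : ∀ {u v w n} → Walk G u v n → Adj v w → Walk G u w (suc n)
  here     ▷ e′ = step e′ here
  step e p ▷ e′ = step e (p ▷ e′)

module ColourCodes (G : Graph) {m : ℕ} (c : Graph.V G → Fin m) where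
  open Graph G using (V)

  Occurs : Fin m → Set
  Occurs i = ∃ λ x → c x ≡ i

  Reaches : V → Fin m → ℕ → Set
  Reaches v i n = ∃ λ x → c x ≡ i × Walk G v x n

  least⇒colorDist : ∀ {v i n} → Least (Reaches v i) n → ColorDist G m c v i n
  least⇒colorDist (r , min) = r , λ x n e w → min n (x , e , w)

  colorDist⇒occurs : ∀ {v i n} → ColorDist G m c v i n → Occurs i
  colorDist⇒occurs ((x , e , _) , _) = x , e

  colorDist-unique : ∀ {v i n n′} → ColorDist G m c v i n → ColorDist G m c v i n′ → n ≡ n′
  colorDist-unique ((x , e , w) , min) ((x′ , e′ , w′) , min′) =
    ≤-antisym (min x′ _ e′ w′) (min′ x _ e w)

  BoundedDist : ℕ → V → Fin m → Set
  BoundedDist L v i = (∃ λ n → n ≤ L × ColorDist G m c v i n) ⊎ ¬ Occurs i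

  code : ∀ {L v i} → BoundedDist L v i → Fin (suc (suc L))
  code (inj₁ (n , n≤L , _)) = suc (fromℕ< (s≤s n≤L))
  code (inj₂ _)             = zero

  ¬¬-boundedDist : ∀ {L v} → (∀ i → Occurs i → ∃ λ n → n ≤ L × Reaches v i n) →
                   ∀ i → ¬ ¬ BoundedDist L v i
  ¬¬-boundedDist near i k = ¬¬-excluded-middle λ where
    (no ¬o) → k (inj₂ ¬o)
    (yes o) → let n , n≤L , r = near i o in ¬¬-least n r λ (l , least) →
      k (inj₁ (l , ≤-trans (proj₂ least n r) n≤L , least⇒colorDist least))

  sameColorDist : ∀ {L u v i} (d : BoundedDist L u i) (d′ : BoundedDist L v i) → code d ≡ code d′ →
                  ∀ n → ColorDist G m c u i n ⇔ ColorDist G m c v i n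
  sameColorDist (inj₁ (n , _ , du)) (inj₁ (n′ , _ , dv)) eq _ = mk⇔
    (λ dk → subst _ (sym (trans (colorDist-unique dk du) n≡n′)) dv)
    (λ dk → subst _ (sym (trans (colorDist-unique dk dv) (sym n≡n′))) du)
    where
    n≡n′ : n ≡ n′
    n≡n′ = Finₚ.fromℕ<-injective n n′ _ _ (Finₚ.suc-injective eq)
  sameColorDist (inj₁ (_ , _ , du)) (inj₂ ¬o) _ _ = ⊥-elim (¬o (colorDist⇒occurs du))
  sameColorDist (inj₂ ¬o) (inj₁ (_ , _ , dv)) _ _ = ⊥-elim (¬o (colorDist⇒occurs dv))
  sameColorDist (inj₂ ¬o) (inj₂ ¬o′)          _ _ =
    mk⇔ (⊥-elim ∘ ¬o ∘ colorDist⇒occurs) (⊥-elim ∘ ¬o′ ∘ colorDist⇒occurs)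

  locating⇒family≤codes : IsLocatingColoring G m c → ∀ {s L} (f : Fin s → V) → Injective _≡_ _≡_ f →
                          (∀ a i → BoundedDist L (f a) i) → ¬ (suc (suc L) ^ m < s)
  locating⇒family≤codes (_ , locates) f f-inj dist codes<s
    with a , b , a<b , same ← Finₚ.pigeonhole codes<s (λ a → funToFin (code ∘ dist a)) =
    <-irrefl (cong toℕ (f-inj (locates (f a) (f b) λ i →
      sameColorDist (dist a i) (dist b i) (funToFin-injective _ _ same i)))) a<b

ExponentialGrowth : (G : Graph) → Graph.V G → Set
ExponentialGrowth G r =
  ∀ t → Σ (Fin (2 ^ t) → Graph.V G) λ f → Injective _≡_ _≡_ f × (∀ a → Walk G (f a) r (suc t))

exponentialGrowth⇒locChromInfinite : (G : Graph) (r : Graph.V G) → (∀ v → ∃ (Walk G r v)) →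
                                     ExponentialGrowth G r → LocChromInfinite G
exponentialGrowth⇒locChromInfinite G r from-r grows m c locating =
  ¬¬-Π-Fin representative λ rep →
  let B , B-bound    = finite-bound rep
      t , codes<2^t  = exponential-beats-polynomial (3 + B) m
      f , f-inj , up = grows t
      near : ∀ a i → Occurs i → ∃ λ n → n ≤ suc (B + t) × Reaches (f a) i n
      near a i o = let n , n≤B , reaches = B-bound i ; x , e , w = reaches o in
        suc t + n , s≤s (subst (_≤ B + t) (+-comm n t) (+-monoˡ-≤ t n≤B)) , x , e , up a ++ʷ w
  in ¬¬-Π-Fin (λ a → ¬¬-Π-Fin (¬¬-boundedDist (near a))) λ dist →
     locating⇒family≤codes locating f f-inj dist codes<2^t
  where
  open ColourCodes G c
  representative : ∀ i → ¬ ¬ ∃ λ n → Occurs i → Reaches r i n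
  representative i = independence-of-premise 0 λ (x , e) → let n , w = from-r x in n , x , e , w

fromRoot : ∀ {k} (v : TVertex k) → ∃ (Walk (T k) root v)
fromRoot root             = 0 , here
fromRoot (node i [])      = 1 , step (inj₁ (top i)) here
fromRoot (node i (j ∷ p)) = let n , w = fromRoot (node i p) in suc n , w ▷ inj₁ (deep i p j)

-- The path to the a-th descendant, at depth t + 1, of the first child of the root that
-- only ever steps to the first two children.
branch : ∀ {k} t → Fin (2 ^ t) → List (Fin (suc (suc k)))
branch zero    _ = []
branch (suc t) a =
  inject≤ (proj₁ (remQuot {2} (2 ^ t) a)) (s≤s (s≤s z≤n)) ∷ branch t (proj₂ (remQuot {2} (2 ^ t) a))

branch-injective : ∀ {k} t → Injective _≡_ _≡_ (branch {k} t)
branch-injective zero    {zero} {zero} _ = refl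
branch-injective (suc t) {a}    {b}    eq = begin
  a                                       ≡⟨ Finₚ.combine-remQuot {2} (2 ^ t) a ⟨
  uncurry combine (remQuot {2} (2 ^ t) a) ≡⟨ cong (uncurry combine) (cong₂ _,_ heads tails) ⟩
  uncurry combine (remQuot {2} (2 ^ t) b) ≡⟨ Finₚ.combine-remQuot {2} (2 ^ t) b ⟩
  b                                       ∎
  where
  open ≡-Reasoning
  heads : proj₁ (remQuot {2} (2 ^ t) a) ≡ proj₁ (remQuot {2} (2 ^ t) b)
  heads = Finₚ.inject≤-injective _ _ _ _ (∷-injectiveˡ eq)
  tails : proj₂ (remQuot {2} (2 ^ t) a) ≡ proj₂ (remQuot {2} (2 ^ t) b)
  tails = branch-injective t (∷-injectiveʳ eq)

climb : ∀ {k} t a → Walk (T (3 + k)) (node zero (branch t a)) root (suc t)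
climb zero    _ = step (inj₂ (top zero)) here
climb (suc t) a = step (inj₂ (deep zero _ _)) (climb t (proj₂ (remQuot {2} (2 ^ t) a)))

T-exponentialGrowth : ∀ k → ExponentialGrowth (T (3 + k)) root
T-exponentialGrowth k t = node zero ∘ branch t , branch-injective t ∘ node-injective , climb t
  where
  node-injective : ∀ {i p q} → node {3 + k} i p ≡ node i q → p ≡ q
  node-injective refl = refl

theorem5 : (k : ℕ) → 3 ≤ k → LocChromInfinite (T k)
theorem5 (suc (suc (suc k))) (s≤s (s≤s (s≤s _))) =
  exponentialGrowth⇒locChromInfinite (T (3 + k)) root fromRoot (T-exponentialGrowth k)
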